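{- If $H$ is a graph with $\gamma_I(H)=\gamma(H)=3$, then for any graph $G$, $\gamma_I(G\circ H)=\gamma_{(2,2,2,0)}(G)$.
   Context: All graphs are finite and simple; $N(v)$ is the open neighbourhood of $v$, and $f(S)=\sum_{u\in S}f(u)$. For a vector $w=(w_0,\dots,w_l)$ of nonnegative integers with $w_0\ge1$, a function $f:V(G)\to\{0,1,\dots,l\}$ is $w$-dominating if $f(N(v))\ge w_i$ for every vertex $v$ with $f(v)=i$; its weight is $\sum_v f(v)$, and $\gamma_{(w_0,\dots,w_l)}(G)$ is the minimum weight of a $w$-dominating function. The Italian domination number is $\gamma_I=\gamma_{(2,0,0)}$. $\gamma(H)$ is the domination number. The lexicographic product $G\circ H$ has vertex set $V(G)\times V(H)$, with $(u,v)(x,y)$ an edge iff $ux\in E(G)$, or $u=x$ and $vy\in E(H)$. -}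

module Defs where

open import Data.Nat using (ℕ; zero; suc; _+_; _*_; _≤_)
open import Data.Fin using (Fin; toℕ; remQuot) renaming (zero to fzero; suc to fsuc)
open import Data.Fin.Properties using (_≟_)
open import Data.Bool using (Bool; true; false; if_then_else_; _∧_; _∨_)
open import Data.Sum using (_⊎_)
open import Data.Empty using (⊥-elim)
open import Data.Vec using (Vec; lookup; _∷_; [])
open import Data.Product using (Σ; ∃; _×_; _,_; proj₁; proj₂)
open import Function using (_∘_)
open import Relation.Nullary.Decidable using (⌊_⌋; yes; no)
open import Relation.Binary.PropositionalEquality

record Graph : Set where
  field
    n      : ℕ
    adj    : Fin n → Fin n → Bool
    adj-sym    : ∀ u v → adj u v ≡ adj v u
    adj-irrefl : ∀ u → adj u u ≡ false

open Graph public

sumFin : ∀ {n} → (Fin n → ℕ) → ℕ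
sumFin {zero}  f = 0
sumFin {suc n} f = f fzero + sumFin (λ i → f (fsuc i))

nbrSum : (G : Graph) → (Fin (n G) → ℕ) → Fin (n G) → ℕ
nbrSum G f v = sumFin (λ u → if adj G v u then f u else 0)

IsWDom : (G : Graph) {l : ℕ} → Vec ℕ (suc l) → (Fin (n G) → Fin (suc l)) → Set
IsWDom G w f = ∀ v → lookup w (f v) ≤ nbrSum G (toℕ ∘ f) v

weight : ∀ {m l} → (Fin m → Fin (suc l)) → ℕ
weight f = sumFin (toℕ ∘ f)

IsWDomNumber : (G : Graph) {l : ℕ} → Vec ℕ (suc l) → ℕ → Set
IsWDomNumber G {l} w k =
  (Σ (Fin (n G) → Fin (suc l)) λ f → IsWDom G w f × weight f ≡ k)
  × (∀ (f : Fin (n G) → Fin (suc l)) → IsWDom G w f → k ≤ weight f)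

IsItalianNumber : Graph → ℕ → Set
IsItalianNumber G k = IsWDomNumber G (2 ∷ 0 ∷ 0 ∷ []) k

IsDominating : (G : Graph) → (Fin (n G) → Bool) → Set
IsDominating G S = ∀ v → S v ≡ true ⊎ (Σ (Fin (n G)) λ u → S u ≡ true × adj G v u ≡ true)

card : ∀ {m} → (Fin m → Bool) → ℕ
card S = sumFin (λ u → if S u then 1 else 0)

IsDomNumber : Graph → ℕ → Set
IsDomNumber G k =
  (Σ (Fin (n G) → Bool) λ S → IsDominating G S × card S ≡ k)
  × (∀ S → IsDominating G S → k ≤ card S)

-- Lexicographic product G ∘ H on Fin (|G| * |H|), with vertex i identified
-- with the pair remQuot i = (u , v) ∈ V(G) × V(H) (a bijection).
private
  eqB : ∀ {m} → Fin m → Fin m → Bool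
  eqB a b = ⌊ a ≟ b ⌋

  eqB-sym : ∀ {m} (a b : Fin m) → eqB a b ≡ eqB b a
  eqB-sym a b with a ≟ b | b ≟ a
  ... | yes _ | yes _ = refl
  ... | no _  | no _  = refl
  ... | yes p | no q  = ⊥-elim (q (sym p))
  ... | no p  | yes q = ⊥-elim (p (sym q))

  eqB-refl : ∀ {m} (a : Fin m) → eqB a a ≡ true
  eqB-refl a with a ≟ a
  ... | yes _ = refl
  ... | no p  = ⊥-elim (p refl)

lexAdjP : (G H : Graph) → Fin (n G) × Fin (n H) → Fin (n G) × Fin (n H) → Bool
lexAdjP G H (u , v) (x , y) = adj G u x ∨ (eqB u x ∧ adj H v y)

lexAdj : (G H : Graph) → Fin (n G * n H) → Fin (n G * n H) → Bool
lexAdj G H i j = lexAdjP G H (remQuot (n H) i) (remQuot (n H) j)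

lexAdjP-sym : (G H : Graph) → ∀ p q → lexAdjP G H p q ≡ lexAdjP G H q p
lexAdjP-sym G H (u , v) (x , y)
  rewrite adj-sym G u x | eqB-sym u x | adj-sym H v y = refl

lexAdjP-irrefl : (G H : Graph) → ∀ p → lexAdjP G H p p ≡ false
lexAdjP-irrefl G H (u , v) rewrite adj-irrefl G u | eqB-refl u | adj-irrefl H v = refl

_∘ₗ_ : Graph → Graph → Graph
G ∘ₗ H = record
  { n      = n G * n H
  ; adj    = lexAdj G H
  ; adj-sym    = λ i j → lexAdjP-sym G H (remQuot (n H) i) (remQuot (n H) j)
  ; adj-irrefl = λ i → lexAdjP-irrefl G H (remQuot (n H) i)
  }

-- Write the weights of a function g on G ∘ H fibrewise.  The neighbourhood sum of
-- (u , v) is the sum of the fibre weights over N_G(u) plus the sum of g(u , ·)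
-- over N_H(v).  A (2,2,2,0)-dominating f on G lifts to an Italian function of
-- the same weight by placing f(x) ∈ {1, 2} on one vertex of the fibre over x and
-- an Italian function of H of weight 3 on the fibres with f(x) = 3.  Conversely,
-- capping the fibre weights of an Italian g at 3 does not increase the weight and
-- gives a (2,2,2,0)-dominating function: a fibre of weight at most 2 has support
-- of size at most 2 < γ(H), so some (u , v) in it sees no weight inside its
-- fibre, and the Italian condition there puts weight at least 2 on N_G(u).

module Submission where

open import Defs
open import Data.Nat using (ℕ; zero; suc; _+_; _*_; _≤_; _<_; _⊓_; z≤n; s≤s; _≤?_)
open import Data.Nat.Properties
  using ( ≤-refl; ≤-reflexive; ≤-trans; ≤-antisym; ≤⇒≯; ≰⇒>; +-mono-≤; m≤m+n; m≤n+m
        ; +-identityʳ; +-assoc; +-commutativeSemigroup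
        ; ⊓-sel; ⊓-zeroʳ; ⊓-monoʳ-≤; ⊓-monoˡ-≤; m⊓n≤m; m⊓n≤n; module ≤-Reasoning)
open import Algebra.Properties.CommutativeSemigroup +-commutativeSemigroup using (interchange)
open import Data.Fin using (Fin; toℕ; remQuot; combine; _↑ˡ_; _↑ʳ_) renaming (zero to fzero; suc to fsuc)
open import Data.Fin.Patterns using (0F; 1F; 2F; 3F)
open import Data.Fin.Properties using (_≟_; remQuot-combine; combine-remQuot; toℕ-injective; any?; ¬∀⟶∃¬)
open import Data.Bool using (Bool; true; false; if_then_else_; _∧_; _∨_)
import Data.Bool.Properties as Bool
open import Data.Sum using (_⊎_; inj₁; inj₂)
open import Data.Vec using (Vec; lookup; _∷_; [])
open import Data.Product using (Σ; _×_; _,_; proj₁; proj₂; uncurry)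
open import Function using (_∘_)
open import Relation.Nullary using (¬_; Dec; yes; no; contradiction)
open import Relation.Nullary.Decidable using (⌊_⌋; _⊎-dec_; _×-dec_)
open import Relation.Binary.PropositionalEquality

sumFin-cong : ∀ {m} {F F′ : Fin m → ℕ} → (∀ x → F x ≡ F′ x) → sumFin F ≡ sumFin F′
sumFin-cong {zero}  F≗F′ = refl
sumFin-cong {suc m} F≗F′ = cong₂ _+_ (F≗F′ fzero) (sumFin-cong (F≗F′ ∘ fsuc))

sumFin-mono-≤ : ∀ {m} {F F′ : Fin m → ℕ} → (∀ x → F x ≤ F′ x) → sumFin F ≤ sumFin F′
sumFin-mono-≤ {zero}  F≤F′ = z≤n
sumFin-mono-≤ {suc m} F≤F′ = +-mono-≤ (F≤F′ fzero) (sumFin-mono-≤ (F≤F′ ∘ fsuc))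

sumFin-zero : ∀ m → sumFin {m} (λ _ → 0) ≡ 0
sumFin-zero zero    = refl
sumFin-zero (suc m) = sumFin-zero m

sumFin-distrib-+ : ∀ {m} (F F′ : Fin m → ℕ) → sumFin (λ x → F x + F′ x) ≡ sumFin F + sumFin F′
sumFin-distrib-+ {zero}  F F′ = refl
sumFin-distrib-+ {suc m} F F′ =
  trans (cong (F fzero + F′ fzero +_) (sumFin-distrib-+ (F ∘ fsuc) (F′ ∘ fsuc)))
        (interchange (F fzero) (F′ fzero) (sumFin (F ∘ fsuc)) (sumFin (F′ ∘ fsuc)))

sumFin-indicator : ∀ {m} (u : Fin m) c → sumFin (λ x → if ⌊ u ≟ x ⌋ then c else 0) ≡ c
sumFin-indicator {suc m} fzero    c = trans (cong (c +_) (sumFin-zero m)) (+-identityʳ c)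
sumFin-indicator {suc m} (fsuc u) c =
  trans (sumFin-cong (λ x → cong (λ b → if b then c else 0) (≟-fsuc x))) (sumFin-indicator u c)
  where
  ≟-fsuc : ∀ x → ⌊ fsuc u ≟ fsuc x ⌋ ≡ ⌊ u ≟ x ⌋
  ≟-fsuc x with u ≟ x
  ... | yes _ = refl
  ... | no  _ = refl

sumFin-↑ : ∀ m k (F : Fin (m + k) → ℕ) →
  sumFin F ≡ sumFin (λ i → F (i ↑ˡ k)) + sumFin (λ j → F (m ↑ʳ j))
sumFin-↑ zero    k F = refl
sumFin-↑ (suc m) k F =
  trans (cong (F fzero +_) (sumFin-↑ m k (F ∘ fsuc))) (sym (+-assoc (F fzero) _ _))

sumFin-combine : ∀ m k (F : Fin (m * k) → ℕ) →
  sumFin F ≡ sumFin {m} (λ x → sumFin {k} (λ y → F (combine x y)))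
sumFin-combine zero    k F = refl
sumFin-combine (suc m) k F =
  trans (sumFin-↑ k (m * k) F)
        (cong (sumFin (λ i → F (i ↑ˡ (m * k))) +_) (sumFin-combine m k (λ j → F (k ↑ʳ j))))

⊓-subadditive : ∀ k a b → k ⊓ (a + b) ≤ k ⊓ a + k ⊓ b
⊓-subadditive k a b with ⊓-sel k a | ⊓-sel k b
... | inj₁ k⊓a≡k | _ rewrite k⊓a≡k = ≤-trans (m⊓n≤m k (a + b)) (m≤m+n k (k ⊓ b))
... | inj₂ _ | inj₁ k⊓b≡k rewrite k⊓b≡k = ≤-trans (m⊓n≤m k (a + b)) (m≤n+m k (k ⊓ a))
... | inj₂ k⊓a≡a | inj₂ k⊓b≡b rewrite k⊓a≡a | k⊓b≡b = m⊓n≤n k (a + b)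

⊓-sumFin : ∀ k {m} (F : Fin m → ℕ) → k ⊓ sumFin F ≤ sumFin (λ x → k ⊓ F x)
⊓-sumFin k {zero}  F = ≤-reflexive (⊓-zeroʳ k)
⊓-sumFin k {suc m} F =
  ≤-trans (⊓-subadditive k (F fzero) _) (+-mono-≤ ≤-refl (⊓-sumFin k (F ∘ fsuc)))

inhabited-if-sumFin≡suc : ∀ {m} {F : Fin m → ℕ} {s} → sumFin F ≡ suc s → Fin m
inhabited-if-sumFin≡suc {zero}  ()
inhabited-if-sumFin≡suc {suc m} _ = fzero

module _ (G : Graph) where

  nbrSum-cong : ∀ {F F′ : Fin (n G) → ℕ} → (∀ x → F x ≡ F′ x) → ∀ u → nbrSum G F u ≡ nbrSum G F′ u
  nbrSum-cong F≗F′ u = sumFin-cong (λ x → cong (λ r → if adj G u x then r else 0) (F≗F′ x))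

  nbrSum-mono-≤ : ∀ {F F′ : Fin (n G) → ℕ} → (∀ x → F x ≤ F′ x) → ∀ u → nbrSum G F u ≤ nbrSum G F′ u
  nbrSum-mono-≤ {F} {F′} F≤F′ u = sumFin-mono-≤ masked
    where
    masked : ∀ x → (if adj G u x then F x else 0) ≤ (if adj G u x then F′ x else 0)
    masked x with adj G u x
    ... | true  = F≤F′ x
    ... | false = z≤n

  ⊓-nbrSum : ∀ k (F : Fin (n G) → ℕ) u → k ⊓ nbrSum G F u ≤ nbrSum G (λ x → k ⊓ F x) u
  ⊓-nbrSum k F u = ≤-trans (⊓-sumFin k (λ x → if adj G u x then F x else 0)) (sumFin-mono-≤ masked)
    where
    masked : ∀ x → k ⊓ (if adj G u x then F x else 0) ≤ (if adj G u x then k ⊓ F x else 0)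
    masked x with adj G u x
    ... | true  = ≤-refl
    ... | false = ≤-reflexive (⊓-zeroʳ k)

module _ (G H : Graph) where

  fibre : ∀ {A : Set} → (Fin (n G * n H) → A) → Fin (n G) → Fin (n H) → A
  fibre h x y = h (combine x y)

  glue : ∀ {A : Set} → (Fin (n G) → Fin (n H) → A) → Fin (n G * n H) → A
  glue F i = uncurry F (remQuot (n H) i)

  fibre-glue : ∀ {A : Set} (F : Fin (n G) → Fin (n H) → A) x y → fibre (glue F) x y ≡ F x y
  fibre-glue F x y = cong (uncurry F) (remQuot-combine x y)

  ∀-by-combine : (P : Fin (n G * n H) → Set) →
    (∀ (u : Fin (n G)) (v : Fin (n H)) → P (combine u v)) → ∀ i → P i
  ∀-by-combine P P-combine i =
    subst P (combine-remQuot {n G} (n H) i) (uncurry P-combine (remQuot {n G} (n H) i))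

  weight-fibres : ∀ {l} (g : Fin (n G * n H) → Fin (suc l)) → weight g ≡ sumFin (weight ∘ fibre g)
  weight-fibres g = sumFin-combine (n G) (n H) (toℕ ∘ g)

  weight-glue : ∀ {l} (F : Fin (n G) → Fin (n H) → Fin (suc l)) → weight (glue F) ≡ sumFin (weight ∘ F)
  weight-glue F = trans (weight-fibres (glue F))
    (sumFin-cong (λ x → sumFin-cong (λ y → cong toℕ (fibre-glue F x y))))

  -- The two kinds of neighbours of (u , v), those with x ∈ N_G(u) and those with
  -- x = u and y ∈ N_H(v), never overlap because G is irreflexive.
  nbrSum-∘ₗ : (h : Fin (n G * n H) → ℕ) → ∀ u v →
    nbrSum (G ∘ₗ H) h (combine u v) ≡ nbrSum G (sumFin ∘ fibre h) u + nbrSum H (fibre h u) v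
  nbrSum-∘ₗ h u v = begin
    nbrSum (G ∘ₗ H) h (combine u v)
      ≡⟨ sumFin-combine (n G) (n H) _ ⟩
    sumFin (λ x → sumFin (λ y → if lexAdj G H (combine u v) (combine x y) then fibre h x y else 0))
      ≡⟨ sumFin-cong (λ x → sumFin-cong (λ y →
           cong₂ (λ p q → if lexAdjP G H p q then fibre h x y else 0)
                 (remQuot-combine u v) (remQuot-combine x y))) ⟩
    sumFin (λ x → sumFin (λ y → if lexAdjP G H (u , v) (x , y) then fibre h x y else 0))
      ≡⟨ sumFin-cong fibre-contribution ⟩
    sumFin (λ x → (if adj G u x then sumFin (fibre h x) else 0) + (if ⌊ u ≟ x ⌋ then inner else 0))
      ≡⟨ sumFin-distrib-+ {n G} _ _ ⟩
    nbrSum G (sumFin ∘ fibre h) u + sumFin (λ x → if ⌊ u ≟ x ⌋ then inner else 0)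
      ≡⟨ cong (nbrSum G (sumFin ∘ fibre h) u +_) (sumFin-indicator u inner) ⟩
    nbrSum G (sumFin ∘ fibre h) u + inner ∎
    where
    open ≡-Reasoning
    inner : ℕ
    inner = nbrSum H (fibre h u) v
    fibre-contribution : ∀ x →
      sumFin (λ y → if adj G u x ∨ (⌊ u ≟ x ⌋ ∧ adj H v y) then fibre h x y else 0)
        ≡ (if adj G u x then sumFin (fibre h x) else 0) + (if ⌊ u ≟ x ⌋ then inner else 0)
    fibre-contribution x with adj G u x in uGx | u ≟ x
    ... | true  | yes refl = contradiction (trans (sym uGx) (adj-irrefl G u)) (λ ())
    ... | true  | no  _    = sym (+-identityʳ _)
    ... | false | yes refl = refl
    ... | false | no  _    = sumFin-zero (n H)

  IsWDom-∘ₗ⇒fibrewise : ∀ {l} {w : Vec ℕ (suc l)} {g : Fin (n G * n H) → Fin (suc l)} →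
    IsWDom (G ∘ₗ H) w g →
    ∀ u v → lookup w (fibre g u v) ≤ nbrSum G (weight ∘ fibre g) u + nbrSum H (toℕ ∘ fibre g u) v
  IsWDom-∘ₗ⇒fibrewise {w = w} {g} g-dom u v =
    subst (lookup w (fibre g u v) ≤_) (nbrSum-∘ₗ (toℕ ∘ g) u v) (g-dom (combine u v))

  fibrewise⇒IsWDom-glue : ∀ {l} {w : Vec ℕ (suc l)} {F : Fin (n G) → Fin (n H) → Fin (suc l)} →
    (∀ u v → lookup w (F u v) ≤ nbrSum G (weight ∘ F) u + nbrSum H (toℕ ∘ F u) v) →
    IsWDom (G ∘ₗ H) w (glue F)
  fibrewise⇒IsWDom-glue {w = w} {F} F-dom =
    ∀-by-combine (λ i → lookup w (glue F i) ≤ nbrSum (G ∘ₗ H) (toℕ ∘ glue F) i) λ u v →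
    subst₂ _≤_ (cong (lookup w) (sym (fibre-glue F u v)))
      (sym (trans (nbrSum-∘ₗ (toℕ ∘ glue F) u v)
        (cong₂ _+_ (nbrSum-cong G (λ x → sumFin-cong (λ y → cong toℕ (fibre-glue F x y))) u)
                   (nbrSum-cong H (λ y → cong toℕ (fibre-glue F u y)) v))))
      (F-dom u v)

italian : Vec ℕ 3
italian = 2 ∷ 0 ∷ 0 ∷ []

w2220 : Vec ℕ 4
w2220 = 2 ∷ 2 ∷ 2 ∷ 0 ∷ []

lookup-italian-≤2 : ∀ c → lookup italian c ≤ 2
lookup-italian-≤2 0F = ≤-refl
lookup-italian-≤2 1F = z≤n
lookup-italian-≤2 2F = z≤n

lookup-w2220-≤2 : ∀ c → lookup w2220 c ≤ 2
lookup-w2220-≤2 0F = ≤-refl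
lookup-w2220-≤2 1F = ≤-refl
lookup-w2220-≤2 2F = ≤-refl
lookup-w2220-≤2 3F = z≤n

record WDomReduces (G : Graph) {l : ℕ} (w : Vec ℕ (suc l))
                   (G′ : Graph) {l′ : ℕ} (w′ : Vec ℕ (suc l′)) : Set where
  field
    reduce : ∀ f → IsWDom G w f →
      Σ (Fin (n G′) → Fin (suc l′)) λ f′ → IsWDom G′ w′ f′ × weight f′ ≤ weight f

open WDomReduces

IsWDomNumber-transport : ∀ {G G′ l l′} {w : Vec ℕ (suc l)} {w′ : Vec ℕ (suc l′)} {k} →
  WDomReduces G w G′ w′ → WDomReduces G′ w′ G w → IsWDomNumber G w k → IsWDomNumber G′ w′ k
IsWDomNumber-transport {G′ = G′} {w′ = w′} {k} to from ((f , f-dom , f-weight) , minimal)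
  with to .reduce f f-dom
... | f′ , f′-dom , f′≤f =
  (f′ , f′-dom , ≤-antisym (≤-trans f′≤f (≤-reflexive f-weight)) (lower-bound f′ f′-dom)) , lower-bound
  where
  lower-bound : ∀ g → IsWDom G′ w′ g → k ≤ weight g
  lower-bound g g-dom with from .reduce g g-dom
  ... | f″ , f″-dom , f″≤g = ≤-trans (minimal f″ f″-dom) f″≤g

module Lift (H : Graph) {h₀ : Fin (n H) → Fin 3}
            (h₀-italian : IsWDom H italian h₀) (h₀-weight : weight h₀ ≡ 3) (v₀ : Fin (n H)) where

  point : Fin 3 → Fin (n H) → Fin 3
  point c y = if ⌊ v₀ ≟ y ⌋ then c else 0F

  weight-point : ∀ c → weight (point c) ≡ toℕ c
  weight-point c = trans (sumFin-cong toℕ-point) (sumFin-indicator v₀ (toℕ c))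
    where
    toℕ-point : ∀ y → toℕ (point c y) ≡ (if ⌊ v₀ ≟ y ⌋ then toℕ c else 0)
    toℕ-point y with ⌊ v₀ ≟ y ⌋
    ... | true  = refl
    ... | false = refl

  fibreOf : Fin 4 → Fin (n H) → Fin 3
  fibreOf 0F = point 0F
  fibreOf 1F = point 1F
  fibreOf 2F = point 2F
  fibreOf 3F = h₀

  weight-fibreOf : ∀ c → weight (fibreOf c) ≡ toℕ c
  weight-fibreOf 0F = weight-point 0F
  weight-fibreOf 1F = weight-point 1F
  weight-fibreOf 2F = weight-point 2F
  weight-fibreOf 3F = h₀-weight

  lift : ∀ G → WDomReduces G w2220 (G ∘ₗ H) italian
  lift G .reduce f f-dom =
    glue G H F , fibrewise⇒IsWDom-glue G H {w = italian} F-dom , ≤-reflexive weight-lift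
    where
    F : Fin (n G) → Fin (n H) → Fin 3
    F = fibreOf ∘ f
    weight-lift : weight (glue G H F) ≡ weight f
    weight-lift = trans (weight-glue G H F) (sumFin-cong (weight-fibreOf ∘ f))
    demand : ∀ u v →
      lookup italian (fibreOf (f u) v) ≤ nbrSum G (toℕ ∘ f) u + nbrSum H (toℕ ∘ fibreOf (f u)) v
    demand u v with f u | f-dom u
    ... | 0F | f-nbr≥2 = ≤-trans (lookup-italian-≤2 (point 0F v)) (≤-trans f-nbr≥2 (m≤m+n _ _))
    ... | 1F | f-nbr≥2 = ≤-trans (lookup-italian-≤2 (point 1F v)) (≤-trans f-nbr≥2 (m≤m+n _ _))
    ... | 2F | f-nbr≥2 = ≤-trans (lookup-italian-≤2 (point 2F v)) (≤-trans f-nbr≥2 (m≤m+n _ _))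
    ... | 3F | _       = ≤-trans (h₀-italian v) (m≤n+m _ _)
    F-dom : ∀ u v → lookup italian (F u v) ≤ nbrSum G (weight ∘ F) u + nbrSum H (toℕ ∘ F u) v
    F-dom u v = subst (λ s → lookup italian (F u v) ≤ s + nbrSum H (toℕ ∘ F u) v)
      (sym (nbrSum-cong G (weight-fibreOf ∘ f) u)) (demand u v)

below-domination⇒zero-closed-nbhd : ∀ (H : Graph) {k} → (∀ S → IsDominating H S → k ≤ card S) →
  (h : Fin (n H) → ℕ) → sumFin h < k → Σ (Fin (n H)) λ v → h v ≡ 0 × nbrSum H h v ≡ 0
below-domination⇒zero-closed-nbhd H γ-bound h h<k =
  v , vanishes (v-undominated ∘ inj₁) , nbr-vanishes
  where
  positive : ℕ → Bool
  positive zero    = false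
  positive (suc _) = true
  support : Fin (n H) → Bool
  support = positive ∘ h
  card-support≤sum : card support ≤ sumFin h
  card-support≤sum = sumFin-mono-≤ (λ y → indicator≤ (h y))
    where
    indicator≤ : ∀ r → (if positive r then 1 else 0) ≤ r
    indicator≤ zero    = z≤n
    indicator≤ (suc _) = s≤s z≤n
  vanishes : ∀ {r} → ¬ positive r ≡ true → r ≡ 0
  vanishes {zero}  _   = refl
  vanishes {suc _} r≯0 = contradiction refl r≯0
  Dominated : Fin (n H) → Set
  Dominated v = support v ≡ true ⊎ Σ (Fin (n H)) λ y → support y ≡ true × adj H v y ≡ true
  dominated? : ∀ v → Dec (Dominated v)
  dominated? v = (support v Bool.≟ true)
    ⊎-dec any? (λ y → (support y Bool.≟ true) ×-dec (adj H v y Bool.≟ true))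
  undominated : Σ (Fin (n H)) λ v → ¬ Dominated v
  undominated = ¬∀⟶∃¬ (n H) Dominated dominated?
    (λ dom → ≤⇒≯ (≤-trans (γ-bound support dom) card-support≤sum) h<k)
  v : Fin (n H)
  v = proj₁ undominated
  v-undominated : ¬ Dominated v
  v-undominated = proj₂ undominated
  nbr-vanishes : nbrSum H h v ≡ 0
  nbr-vanishes = trans (sumFin-cong masked) (sumFin-zero (n H))
    where
    masked : ∀ y → (if adj H v y then h y else 0) ≡ 0
    masked y with adj H v y in vHy
    ... | true  = vanishes (λ hy>0 → v-undominated (inj₂ (y , hy>0 , vHy)))
    ... | false = refl

capAt3 : ℕ → Fin 4
capAt3 0                   = 0F
capAt3 1                   = 1F
capAt3 2                   = 2F
capAt3 (suc (suc (suc _))) = 3F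

toℕ-capAt3 : ∀ r → toℕ (capAt3 r) ≡ 3 ⊓ r
toℕ-capAt3 0                   = refl
toℕ-capAt3 1                   = refl
toℕ-capAt3 2                   = refl
toℕ-capAt3 (suc (suc (suc _))) = refl

lookup-w2220-capAt3 : ∀ {r} → 3 ≤ r → lookup w2220 (capAt3 r) ≡ 0
lookup-w2220-capAt3 {1}                   (s≤s ())
lookup-w2220-capAt3 {2}                   (s≤s (s≤s ()))
lookup-w2220-capAt3 {suc (suc (suc _))} _ = refl

2≤nbrSum-capAt3 : ∀ G (F : Fin (n G) → ℕ) u → 2 ≤ nbrSum G F u → 2 ≤ nbrSum G (toℕ ∘ capAt3 ∘ F) u
2≤nbrSum-capAt3 G F u 2≤F = begin
  2                           ≤⟨ ⊓-monoʳ-≤ 2 2≤F ⟩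
  2 ⊓ nbrSum G F u            ≤⟨ ⊓-nbrSum G 2 F u ⟩
  nbrSum G (λ x → 2 ⊓ F x) u  ≤⟨ nbrSum-mono-≤ G (λ x → ⊓-monoˡ-≤ (F x) (s≤s (s≤s z≤n))) u ⟩
  nbrSum G (λ x → 3 ⊓ F x) u  ≡⟨ nbrSum-cong G (toℕ-capAt3 ∘ F) u ⟨
  nbrSum G (toℕ ∘ capAt3 ∘ F) u ∎
  where open ≤-Reasoning

project : (G H : Graph) → (∀ S → IsDominating H S → 3 ≤ card S) → WDomReduces (G ∘ₗ H) italian G w2220
project G H γ-bound .reduce g g-dom = capAt3 ∘ R , f-dom , weight-capped
  where
  R : Fin (n G) → ℕ
  R = weight ∘ fibre G H g
  weight-capped : weight (capAt3 ∘ R) ≤ weight g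
  weight-capped =
    ≤-trans (sumFin-mono-≤ (λ x → ≤-trans (≤-reflexive (toℕ-capAt3 (R x))) (m⊓n≤n 3 (R x))))
            (≤-reflexive (sym (weight-fibres G H g)))
  light-fibre : ∀ u → R u < 3 → 2 ≤ nbrSum G R u
  light-fibre u Ru<3 with below-domination⇒zero-closed-nbhd H γ-bound (toℕ ∘ fibre G H g u) Ru<3
  ... | v , g[u,v]≡0 , nbr≡0 = begin
    2                                                ≡⟨ cong (lookup italian) (toℕ-injective {j = 0F} g[u,v]≡0) ⟨
    lookup italian (fibre G H g u v)                 ≤⟨ IsWDom-∘ₗ⇒fibrewise G H {w = italian} g-dom u v ⟩
    nbrSum G R u + nbrSum H (toℕ ∘ fibre G H g u) v  ≡⟨ cong (nbrSum G R u +_) nbr≡0 ⟩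
    nbrSum G R u + 0                                 ≡⟨ +-identityʳ _ ⟩
    nbrSum G R u                                     ∎
    where open ≤-Reasoning
  f-dom : IsWDom G w2220 (capAt3 ∘ R)
  f-dom u with 3 ≤? R u
  ... | yes 3≤Ru = subst (_≤ nbrSum G (toℕ ∘ capAt3 ∘ R) u) (sym (lookup-w2220-capAt3 3≤Ru)) z≤n
  ... | no  3≰Ru =
    ≤-trans (lookup-w2220-≤2 (capAt3 (R u))) (2≤nbrSum-capAt3 G R u (light-fibre u (≰⇒> 3≰Ru)))

theorem2p3 : (H : Graph) → IsItalianNumber H 3 → IsDomNumber H 3 →
    (G : Graph) → (k : ℕ) →
      (IsWDomNumber G (2 ∷ 2 ∷ 2 ∷ 0 ∷ []) k → IsItalianNumber (G ∘ₗ H) k)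
      × (IsItalianNumber (G ∘ₗ H) k → IsWDomNumber G (2 ∷ 2 ∷ 2 ∷ 0 ∷ []) k)
theorem2p3 H ((h₀ , h₀-italian , h₀-weight) , _) (_ , γ-bound) G k =
  IsWDomNumber-transport lift (project G H γ-bound) ,
  IsWDomNumber-transport (project G H γ-bound) lift
  where
  lift : WDomReduces G w2220 (G ∘ₗ H) italian
  lift = Lift.lift H h₀-italian h₀-weight (inhabited-if-sumFin≡suc h₀-weight) G
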